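{- Every connected bipartite graph $G$ with bipartition $(X,Y)$ and at least one edge admits a total colouring $\gamma_t:V(G)\cup E(G)\to\{1,2\}$ such that all vertices in one of $X,Y$ have even sums $\sigma^T$, all vertices in the other have odd sums $\sigma^T$, and the number of elements of $V(G)\cup E(G)$ coloured $1$ exceeds the number of elements coloured $2$, which is non-zero.
   Context: For a total colouring $\gamma_t$ of $G$ (a not necessarily proper map on $V(G)\cup E(G)$), the sum at a vertex $v$ is $\sigma^T(v)=\gamma_t(v)+\sum_{e\ni v}\gamma_t(e)$. -}

module Defs where

open import Data.Nat using (ℕ; zero; suc; _+_; _<_; _≡ᵇ_)
open import Data.Nat.Divisibility using (_∣_)
open import Data.Fin using (Fin; zero; suc)
open import Data.Bool using (Bool; true; false; if_then_else_)
open import Data.Product using (_×_; _,_; proj₁; proj₂; Σ; ∃)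
open import Data.Sum using (_⊎_)
open import Relation.Binary.PropositionalEquality using (_≡_; _≢_)
open import Relation.Nullary using (¬_)
open import Data.Fin using (_≟_)
open import Relation.Nullary.Decidable using (⌊_⌋)

Even : ℕ → Set
Even k = 2 ∣ k

Odd : ℕ → Set
Odd k = ¬ (2 ∣ k)

sumFin : (n : ℕ) → (Fin n → ℕ) → ℕ
sumFin zero    f = 0
sumFin (suc n) f = f zero + sumFin n (λ i → f (suc i))

-- A finite simple graph on vertex set Fin n with m edges, edges listed
-- as ordered pairs of endpoints (the order is irrelevant).
record Graph (n m : ℕ) : Set where
  field
    ends      : Fin m → Fin n × Fin n
    loopless  : ∀ e → proj₁ (ends e) ≢ proj₂ (ends e)
    noParallel : ∀ e f →
      (proj₁ (ends e) ≡ proj₁ (ends f) × proj₂ (ends e) ≡ proj₂ (ends f)) ⊎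
      (proj₁ (ends e) ≡ proj₂ (ends f) × proj₂ (ends e) ≡ proj₁ (ends f)) →
      e ≡ f

open Graph public

Incident : ∀ {n m} → Graph n m → Fin m → Fin n → Set
Incident G e v = (proj₁ (ends G e) ≡ v) ⊎ (proj₂ (ends G e) ≡ v)

Adjacent : ∀ {n m} → Graph n m → Fin n → Fin n → Set
Adjacent {m = m} G u v = Σ (Fin m) λ e →
  ((proj₁ (ends G e) ≡ u) × (proj₂ (ends G e) ≡ v)) ⊎
  ((proj₁ (ends G e) ≡ v) × (proj₂ (ends G e) ≡ u))

data Walk {n m} (G : Graph n m) : Fin n → Fin n → Set where
  stay : ∀ {u} → Walk G u u
  step : ∀ {u w v} → Adjacent G u w → Walk G w v → Walk G u v

Connected : ∀ {n m} → Graph n m → Set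
Connected {n} G = (u v : Fin n) → Walk G u v

-- bipartition (X,Y): X = vertices with side false, Y = side true;
-- every edge joins X to Y.
IsBipartition : ∀ {n m} → Graph n m → (Fin n → Bool) → Set
IsBipartition {m = m} G side = (e : Fin m) →
  side (proj₁ (ends G e)) ≢ side (proj₂ (ends G e))

-- total colouring with colours in {1,2} (not necessarily proper)
record TotalColouring {n m} (G : Graph n m) : Set where
  field
    vcol : Fin n → ℕ
    ecol : Fin m → ℕ
    vcol12 : ∀ v → (vcol v ≡ 1) ⊎ (vcol v ≡ 2)
    ecol12 : ∀ e → (ecol e ≡ 1) ⊎ (ecol e ≡ 2)

open TotalColouring public

incidentᵇ : ∀ {n m} → Graph n m → Fin m → Fin n → Bool
incidentᵇ G e v with proj₁ (ends G e) ≟ v | proj₂ (ends G e) ≟ v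
... | Relation.Nullary.yes _ | _ = true
... | Relation.Nullary.no _ | Relation.Nullary.yes _ = true
... | Relation.Nullary.no _ | Relation.Nullary.no _ = false

σT : ∀ {n m} {G : Graph n m} → TotalColouring G → Fin n → ℕ
σT {n} {m} {G} c v =
  vcol c v + sumFin m (λ e → if incidentᵇ G e v then ecol c e else 0)

countColour : ∀ {n m} {G : Graph n m} → TotalColouring G → ℕ → ℕ
countColour {n} {m} c k =
  sumFin n (λ v → if vcol c v ≡ᵇ k then 1 else 0) +
  sumFin m (λ e → if ecol c e ≡ᵇ k then 1 else 0)

SideParity : ∀ {n m} {G : Graph n m} → (Fin n → Bool) → TotalColouring G →
             (ℕ → Set) → (ℕ → Set) → Set
SideParity {n} side c PX PY =
  (v : Fin n) → (side v ≡ false → PX (σT c v)) × (side v ≡ true → PY (σT c v))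

-- Fix the edge colours.  Each vertex colour is then forced by the parity its sum must have, and
-- exchanging which side is even exchanges the two colours on every vertex.  With all edges coloured
-- 1, if both choices colour some vertex 2, the choice with fewer vertices coloured 2 works.
-- Otherwise one choice colours every vertex 1; recolouring one edge 2 then switches exactly its two
-- endpoints to colour 2.  Of the two choices, one has |V| - 1 elements coloured 2 against |E| + 1
-- coloured 1, the other 3 against |V| + |E| - 3; the first works when |V| ≤ |E| + 1, the second
-- when |E| ≥ 3, and a connected graph with one or two edges has |V| ≤ |E| + 1.
module Submission where

open import Defs
open import Data.Nat
  using (ℕ; zero; suc; _+_; _*_; _≤_; _<_; _≡ᵇ_; z≤n; s≤s; _≤?_; parity)
open import Data.Nat.Properties
  using (+-suc; +-comm; *-zeroʳ; *-identityʳ; m≤m+n; m≤n+m; +-mono-≤; +-mono-≤-<; ≤-trans;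
         ≤-total; ≰⇒>; +-cancelˡ-≤; +-commutativeSemigroup)
open import Data.Nat.Divisibility using (_∣0; ∣1⇒≡1; ∣-refl; ∣m∣n⇒∣m+n; ∣m+n∣m⇒∣n)
open import Data.Parity.Base using (Parity; 0ℙ; 1ℙ; _⁻¹) renaming (_+_ to _⊕_)
import Data.Parity.Properties as Parityₚ
open import Algebra.Properties.CommutativeSemigroup +-commutativeSemigroup
  renaming (interchange to +-interchange)
open import Data.Fin using (Fin; zero; suc; _≟_)
open import Data.Fin.Properties using (injective⇒≤; suc-injective)
open import Data.Bool using (Bool; true; false; if_then_else_)
open import Data.Product using (Σ; ∃; _×_; _,_; proj₁; proj₂)
open import Data.Sum using (_⊎_; inj₁; inj₂)
open import Data.Empty using (⊥-elim)
open import Data.List using (List; []; _∷_; length; lookup)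
open import Data.List.Membership.Propositional using (_∈_)
open import Data.List.Relation.Unary.Any using (here; there; index)
open import Data.List.Relation.Unary.Any.Properties using (lookup-index)
open import Relation.Nullary using (yes; no; contradiction)
open import Relation.Nullary.Decidable using (⌊_⌋; ⌊⌋-map′)
open import Relation.Binary.PropositionalEquality
  using (_≡_; refl; sym; trans; cong; cong₂; subst; subst₂; module ≡-Reasoning)

HasParity : Parity → ℕ → Set
HasParity 0ℙ = Even
HasParity 1ℙ = Odd

hasParity : ∀ k → HasParity (parity k) k
hasParity 0 = 2 ∣0
hasParity 1 = λ 2∣1 → contradiction (∣1⇒≡1 2∣1) λ ()
hasParity (suc (suc k)) with parity k | hasParity k
... | 0ℙ | even = ∣m∣n⇒∣m+n ∣-refl even
... | 1ℙ | odd  = λ 2∣2+k → odd (∣m+n∣m⇒∣n 2∣2+k ∣-refl)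

⁻¹-distribˡ-⊕ : ∀ p q → p ⁻¹ ⊕ q ≡ (p ⊕ q) ⁻¹
⁻¹-distribˡ-⊕ 0ℙ q = refl
⁻¹-distribˡ-⊕ 1ℙ q = sym (Parityₚ.⁻¹-involutive q)

⁻¹-distribʳ-⊕ : ∀ p q → p ⊕ q ⁻¹ ≡ (p ⊕ q) ⁻¹
⁻¹-distribʳ-⊕ 0ℙ q = refl
⁻¹-distribʳ-⊕ 1ℙ q = refl

parity-suc : ∀ k → parity (suc k) ≡ parity k ⁻¹
parity-suc k = sym (Parityₚ.suc-homo-⁻¹ (suc k))

sumFin-cong : ∀ n {f g : Fin n → ℕ} → (∀ i → f i ≡ g i) → sumFin n f ≡ sumFin n g
sumFin-cong zero    f≗g = refl
sumFin-cong (suc n) f≗g = cong₂ _+_ (f≗g zero) (sumFin-cong n (λ i → f≗g (suc i)))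

sumFin-distrib-+ : ∀ n (f g : Fin n → ℕ) →
                   sumFin n (λ i → f i + g i) ≡ sumFin n f + sumFin n g
sumFin-distrib-+ zero    f g = refl
sumFin-distrib-+ (suc n) f g =
  trans (cong ((f zero + g zero) +_) (sumFin-distrib-+ n (λ i → f (suc i)) (λ i → g (suc i))))
        (+-interchange (f zero) (g zero) _ _)

sumFin-const : ∀ n k → sumFin n (λ _ → k) ≡ n * k
sumFin-const zero    k = refl
sumFin-const (suc n) k = cong (k +_) (sumFin-const n k)

sumFin≡0⇒≡0 : ∀ n (f : Fin n → ℕ) → sumFin n f ≡ 0 → ∀ i → f i ≡ 0
sumFin≡0⇒≡0 (suc n) f sum≡0 zero    with f zero
... | zero = refl
sumFin≡0⇒≡0 (suc n) f sum≡0 (suc i) with f zero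
... | zero = sumFin≡0⇒≡0 n (λ i → f (suc i)) sum≡0 i

indicator : Bool → ℕ
indicator b = if b then 1 else 0

sumFin-≟ : ∀ n (a : Fin n) → sumFin n (λ v → indicator ⌊ a ≟ v ⌋) ≡ 1
sumFin-≟ (suc n) zero    = cong suc (trans (sumFin-const n 0) (*-zeroʳ n))
sumFin-≟ (suc n) (suc a) =
  trans (sumFin-cong n (λ i → cong indicator (⌊⌋-map′ (cong suc) suc-injective (a ≟ i))))
        (sumFin-≟ n a)

module _ {n m} (G : Graph n m) where

  indicator-incidentᵇ : ∀ e v →
    indicator (incidentᵇ G e v) ≡
    indicator ⌊ proj₁ (ends G e) ≟ v ⌋ + indicator ⌊ proj₂ (ends G e) ≟ v ⌋
  indicator-incidentᵇ e v with proj₁ (ends G e) ≟ v | proj₂ (ends G e) ≟ v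
  ... | yes p | yes q = ⊥-elim (loopless G e (trans p (sym q)))
  ... | yes _ | no _  = refl
  ... | no _  | yes _ = refl
  ... | no _  | no _  = refl

  incidentᵇ-count : ∀ e → sumFin n (λ v → indicator (incidentᵇ G e v)) ≡ 2
  incidentᵇ-count e = begin
    sumFin n (λ v → indicator (incidentᵇ G e v))     ≡⟨ sumFin-cong n (indicator-incidentᵇ e) ⟩
    sumFin n (λ v → indicator ⌊ a ≟ v ⌋ + indicator ⌊ b ≟ v ⌋)
      ≡⟨ sumFin-distrib-+ n (λ v → indicator ⌊ a ≟ v ⌋) (λ v → indicator ⌊ b ≟ v ⌋) ⟩
    sumFin n (λ v → indicator ⌊ a ≟ v ⌋) + sumFin n (λ v → indicator ⌊ b ≟ v ⌋)
      ≡⟨ cong₂ _+_ (sumFin-≟ n a) (sumFin-≟ n b) ⟩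
    2 ∎
    where
    open ≡-Reasoning
    a = proj₁ (ends G e)
    b = proj₂ (ends G e)

  AdjacencyClosed : (Fin n → Set) → Set
  AdjacencyClosed P = ∀ {u w} → Adjacent G u w → P u → P w

  walk-preserves : ∀ {P} → AdjacencyClosed P → ∀ {u v} → Walk G u v → P u → P v
  walk-preserves closed stay        Pu = Pu
  walk-preserves closed (step u~w w⇝v) Pu = walk-preserves closed w⇝v (closed u~w Pu)

  adjacent⇒incident : ∀ {u w} (u~w : Adjacent G u w) →
                      Incident G (proj₁ u~w) u × Incident G (proj₁ u~w) w
  adjacent⇒incident (e , inj₁ (p , q)) = inj₁ p , inj₂ q
  adjacent⇒incident (e , inj₂ (p , q)) = inj₂ q , inj₁ p

  connected⇒incident : Connected G → Fin m → ∀ v → ∃ λ e → Incident G e v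
  connected⇒incident conn e v =
    walk-preserves (λ u~w _ → proj₁ u~w , proj₂ (adjacent⇒incident u~w))
                   (conn (proj₁ (ends G e)) v) (e , inj₁ refl)

  otherEnd : ∀ {e x} → Incident G e x → Fin n
  otherEnd {e} (inj₁ _) = proj₂ (ends G e)
  otherEnd {e} (inj₂ _) = proj₁ (ends G e)

  incident⇒∈ : ∀ {e x v} (x∈e : Incident G e x) → Incident G e v → v ∈ x ∷ otherEnd x∈e ∷ []
  incident⇒∈ (inj₁ p) (inj₁ q) = here (trans (sym q) p)
  incident⇒∈ (inj₁ p) (inj₂ q) = there (here (sym q))
  incident⇒∈ (inj₂ p) (inj₁ q) = there (here (sym q))
  incident⇒∈ (inj₂ p) (inj₂ q) = here (trans (sym q) p)

enumeration⇒≤length : ∀ {n} (L : List (Fin n)) → (∀ v → v ∈ L) → n ≤ length L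
enumeration⇒≤length L ∈L = injective⇒≤ {f = λ v → index (∈L v)} position-injective
  where
  position-injective : ∀ {u v} → index (∈L u) ≡ index (∈L v) → u ≡ v
  position-injective {u} {v} eq =
    trans (lookup-index (∈L u)) (trans (cong (lookup L) eq) (sym (lookup-index (∈L v))))

one-edge-connected⇒≤2 : ∀ {n} (G : Graph n 1) → Connected G → n ≤ 2
one-edge-connected⇒≤2 G conn = enumeration⇒≤length _ ∈ends
  where
  ∈ends : ∀ v → v ∈ proj₁ (ends G zero) ∷ proj₂ (ends G zero) ∷ []
  ∈ends v with connected⇒incident G conn zero v
  ... | zero , v∈e = incident⇒∈ G (inj₁ refl) v∈e

two-edges-connected⇒meet : ∀ {n} (G : Graph n 2) → Connected G →
                           ∃ λ x → Incident G zero x × Incident G (suc zero) x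
two-edges-connected⇒meet G conn with walk-preserves G closed (conn a c) (inj₁ (inj₁ refl))
  where
  a = proj₁ (ends G zero)
  c = proj₁ (ends G (suc zero))
  Meet = ∃ λ x → Incident G zero x × Incident G (suc zero) x
  -- A walk can only leave the endpoints of edge zero through a vertex it shares with the other edge.
  closed : AdjacencyClosed G (λ v → Incident G zero v ⊎ Meet)
  closed u~w@(zero , _)     _           = inj₁ (proj₂ (adjacent⇒incident G u~w))
  closed u~w@(suc zero , _) (inj₁ u∈e₀) = inj₂ (_ , u∈e₀ , proj₁ (adjacent⇒incident G u~w))
  closed (suc zero , _)     (inj₂ meet) = inj₂ meet
... | inj₁ c∈e₀ = _ , c∈e₀ , inj₁ refl
... | inj₂ meet = meet

two-edges-connected⇒≤3 : ∀ {n} (G : Graph n 2) → Connected G → n ≤ 3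
two-edges-connected⇒≤3 G conn with two-edges-connected⇒meet G conn
... | x , x∈e₀ , x∈e₁ = enumeration⇒≤length (x ∷ otherEnd G x∈e₀ ∷ otherEnd G x∈e₁ ∷ []) ∈ends
  where
  ∈ends : ∀ v → v ∈ x ∷ otherEnd G x∈e₀ ∷ otherEnd G x∈e₁ ∷ []
  ∈ends v with connected⇒incident G conn zero v
  ... | zero , v∈e₀ with incident⇒∈ G x∈e₀ v∈e₀
  ...   | here v≡x         = here v≡x
  ...   | there (here v≡y) = there (here v≡y)
  ∈ends v | suc zero , v∈e₁ with incident⇒∈ G x∈e₁ v∈e₁
  ...   | here v≡x         = here v≡x
  ...   | there (here v≡y) = there (there (here v≡y))

sparse-connected⇒≤ : ∀ {n m} (G : Graph n (suc m)) → Connected G → m ≤ 1 → n ≤ 2 + m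
sparse-connected⇒≤ {m = zero}        G conn _ = one-edge-connected⇒≤2 G conn
sparse-connected⇒≤ {m = suc zero}    G conn _ = two-edges-connected⇒≤3 G conn
sparse-connected⇒≤ {m = suc (suc _)} G conn (s≤s ())

bit : Parity → ℕ
bit 0ℙ = 0
bit 1ℙ = 1

-- 0ℙ stands for colour 1 and 1ℙ for colour 2.
colour : Parity → ℕ
colour p = suc (bit p)

parity-bit : ∀ p → parity (bit p) ≡ p
parity-bit 0ℙ = refl
parity-bit 1ℙ = refl

bit≡0⇒0ℙ : ∀ p → bit p ≡ 0 → p ≡ 0ℙ
bit≡0⇒0ℙ 0ℙ _ = refl

#1ℙ : ∀ {k} → (Fin k → Parity) → ℕ
#1ℙ {k} x = sumFin k (λ i → bit (x i))

#1ℙ+#1ℙ⁻¹ : ∀ k (x : Fin k → Parity) → #1ℙ x + #1ℙ (λ i → x i ⁻¹) ≡ k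
#1ℙ+#1ℙ⁻¹ k x = begin
  #1ℙ x + #1ℙ (λ i → x i ⁻¹)                ≡⟨ sumFin-distrib-+ k _ _ ⟨
  sumFin k (λ i → bit (x i) + bit (x i ⁻¹)) ≡⟨ sumFin-cong k (λ i → bit+bit⁻¹ (x i)) ⟩
  sumFin k (λ _ → 1)                        ≡⟨ sumFin-const k 1 ⟩
  k * 1                                     ≡⟨ *-identityʳ k ⟩
  k ∎
  where
  open ≡-Reasoning
  bit+bit⁻¹ : ∀ p → bit p + bit (p ⁻¹) ≡ 1
  bit+bit⁻¹ 0ℙ = refl
  bit+bit⁻¹ 1ℙ = refl

module _ {n m} (G : Graph n m) where

  byParity : (Fin n → Parity) → (Fin m → Parity) → TotalColouring G
  byParity x y = record
    { vcol   = λ v → colour (x v)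
    ; ecol   = λ e → colour (y e)
    ; vcol12 = λ v → colour∈12 (x v)
    ; ecol12 = λ e → colour∈12 (y e)
    }
    where
    colour∈12 : ∀ p → (colour p ≡ 1) ⊎ (colour p ≡ 2)
    colour∈12 0ℙ = inj₁ refl
    colour∈12 1ℙ = inj₂ refl

  countColour-2 : ∀ x y → countColour (byParity x y) 2 ≡ #1ℙ x + #1ℙ y
  countColour-2 x y = cong₂ _+_ (sumFin-cong n (λ v → is2 (x v))) (sumFin-cong m (λ e → is2 (y e)))
    where
    is2 : ∀ p → (if colour p ≡ᵇ 2 then 1 else 0) ≡ bit p
    is2 0ℙ = refl
    is2 1ℙ = refl

  countColour-1 : ∀ x y → countColour (byParity x y) 1 ≡ #1ℙ (λ v → x v ⁻¹) + #1ℙ (λ e → y e ⁻¹)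
  countColour-1 x y = cong₂ _+_ (sumFin-cong n (λ v → is1 (x v))) (sumFin-cong m (λ e → is1 (y e)))
    where
    is1 : ∀ p → (if colour p ≡ᵇ 1 then 1 else 0) ≡ bit (p ⁻¹)
    is1 0ℙ = refl
    is1 1ℙ = refl

  edgeSum : (Fin m → Parity) → Fin n → ℕ
  edgeSum y v = sumFin m (λ e → if incidentᵇ G e v then colour (y e) else 0)

  -- 1ℙ exactly where colour 1 would give the vertex the wrong parity.
  defect : (Fin m → Parity) → (Fin n → Parity) → Fin n → Parity
  defect y t v = t v ⊕ parity (suc (edgeSum y v))

  completion : (Fin m → Parity) → (Fin n → Parity) → TotalColouring G
  completion y t = byParity (defect y t) y

  parity-σT-completion : ∀ y t v → parity (σT (completion y t) v) ≡ t v
  parity-σT-completion y t v = begin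
    parity (suc (bit d) + S)          ≡⟨ cong parity (+-suc (bit d) S) ⟨
    parity (bit d + suc S)            ≡⟨ Parityₚ.+-homo-+ (bit d) (suc S) ⟩
    parity (bit d) ⊕ q                ≡⟨ cong (_⊕ q) (parity-bit d) ⟩
    (t v ⊕ q) ⊕ q                     ≡⟨ Parityₚ.+-assoc (t v) q q ⟩
    t v ⊕ (q ⊕ q)                     ≡⟨ cong (t v ⊕_) (Parityₚ.p+p≡0ℙ q) ⟩
    t v ⊕ 0ℙ                          ≡⟨ Parityₚ.+-identityʳ (t v) ⟩
    t v ∎
    where
    open ≡-Reasoning
    S = edgeSum y v
    q = parity (suc S)
    d = defect y t v

Admissible : ∀ {n m} {G : Graph n m} → (Fin n → Bool) → TotalColouring G → Set
Admissible side c = (SideParity side c Even Odd ⊎ SideParity side c Odd Even) ×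
                    (0 < countColour c 2) × (countColour c 2 < countColour c 1)

k≤m⊎3<k+m : ∀ k m → (m ≤ 1 → k ≤ m) → k ≤ m ⊎ 3 < k + m
k≤m⊎3<k+m k m small with k ≤? m
... | yes k≤m = inj₁ k≤m
k≤m⊎3<k+m k zero          small | no k≰m = contradiction (small z≤n) k≰m
k≤m⊎3<k+m k (suc zero)    small | no k≰m = contradiction (small (s≤s z≤n)) k≰m
k≤m⊎3<k+m k (suc (suc m)) small | no k≰m =
  inj₂ (+-mono-≤ (≤-trans (s≤s (s≤s (s≤s z≤n))) (≰⇒> k≰m)) (s≤s z≤n))

module Construction {n m} (G : Graph n (suc m)) (conn : Connected G) (side : Fin n → Bool) where

  target : Parity → Fin n → Parity
  target b v = if side v then b ⁻¹ else b

  target-⁻¹ : ∀ b v → target (b ⁻¹) v ≡ target b v ⁻¹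
  target-⁻¹ b v with side v
  ... | true  = refl
  ... | false = refl

  defect-target-⁻¹ : ∀ y b v → defect G y (target (b ⁻¹)) v ≡ defect G y (target b) v ⁻¹
  defect-target-⁻¹ y b v = trans (cong (_⊕ _) (target-⁻¹ b v)) (⁻¹-distribˡ-⊕ (target b v) _)

  sideParity : ∀ y b → SideParity side (completion G y (target b)) (HasParity b) (HasParity (b ⁻¹))
  sideParity y b v = onSide , onSide
    where
    σ = σT (completion G y (target b)) v
    onSide : ∀ {s} → side v ≡ s → HasParity (if s then b ⁻¹ else b) σ
    onSide refl = subst (λ p → HasParity p σ) (parity-σT-completion G y (target b) v) (hasParity σ)

  twos : (Fin (suc m) → Parity) → Parity → ℕ
  twos y b = #1ℙ (defect G y (target b))

  twos+twos⁻¹ : ∀ y b → twos y b + twos y (b ⁻¹) ≡ n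
  twos+twos⁻¹ y b =
    trans (cong (twos y b +_) flipped) (#1ℙ+#1ℙ⁻¹ n (defect G y (target b)))
    where
    flipped : twos y (b ⁻¹) ≡ #1ℙ (λ v → defect G y (target b) v ⁻¹)
    flipped = sumFin-cong n (λ v → cong bit (defect-target-⁻¹ y b v))

  admissible : ∀ y b {t₂ t₁ e₂ e₁} →
    twos y b ≡ t₂ → twos y (b ⁻¹) ≡ t₁ → #1ℙ y ≡ e₂ → #1ℙ (λ e → y e ⁻¹) ≡ e₁ →
    0 < t₂ + e₂ → t₂ + e₂ < t₁ + e₁ → Σ (TotalColouring G) (Admissible side)
  admissible y b refl refl refl refl 0<c₂ c₂<c₁ =
    c , sides b (sideParity y b) ,
    subst (0 <_) (sym count₂) 0<c₂ , subst₂ _<_ (sym count₂) (sym count₁) c₂<c₁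
    where
    c = completion G y (target b)
    sides : ∀ b → SideParity side c (HasParity b) (HasParity (b ⁻¹)) →
            SideParity side c Even Odd ⊎ SideParity side c Odd Even
    sides 0ℙ = inj₁
    sides 1ℙ = inj₂
    count₂ : countColour c 2 ≡ twos y b + #1ℙ y
    count₂ = countColour-2 G _ y
    count₁ : countColour c 1 ≡ twos y (b ⁻¹) + #1ℙ (λ e → y e ⁻¹)
    count₁ = trans (countColour-1 G _ y)
      (cong (_+ #1ℙ (λ e → y e ⁻¹)) (sumFin-cong n (λ v → cong bit (sym (defect-target-⁻¹ y b v)))))

  all1 : Fin (suc m) → Parity
  all1 _ = 0ℙ

  edge₀↦2 : Fin (suc m) → Parity
  edge₀↦2 zero    = 1ℙ
  edge₀↦2 (suc _) = 0ℙ

  balanced : ∀ b → 0 < twos all1 b → twos all1 b ≤ twos all1 (b ⁻¹) →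
             Σ (TotalColouring G) (Admissible side)
  balanced b 0<t t≤t⁻¹ =
    admissible all1 b refl refl
      (trans (sumFin-const (suc m) 0) (*-zeroʳ m))
      (trans (sumFin-const (suc m) 1) (*-identityʳ (suc m)))
      (≤-trans 0<t (m≤m+n _ 0)) (+-mono-≤-< t≤t⁻¹ (s≤s z≤n))

  -- Colouring edge zero 2 instead of 1 changes the sum by one exactly at its endpoints.
  defect-edge₀↦2 : ∀ t v →
    defect G edge₀↦2 t v ≡
    (if incidentᵇ G zero v then defect G all1 t v ⁻¹ else defect G all1 t v)
  defect-edge₀↦2 t v with incidentᵇ G zero v
  ... | true  = trans (cong (t v ⊕_) (parity-suc rest)) (⁻¹-distribʳ-⊕ (t v) (parity rest))
    where rest = sumFin m (λ i → if incidentᵇ G (suc i) v then 1 else 0)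
  ... | false = refl

  twos-edge₀↦2 : ∀ b → twos all1 b ≡ 0 → twos edge₀↦2 b ≡ 2
  twos-edge₀↦2 b none = trans (sumFin-cong n endpoint) (incidentᵇ-count G zero)
    where
    unchanged : ∀ v → defect G all1 (target b) v ≡ 0ℙ
    unchanged v = bit≡0⇒0ℙ _ (sumFin≡0⇒≡0 n (λ u → bit (defect G all1 (target b) u)) none v)
    endpoint : ∀ v → bit (defect G edge₀↦2 (target b) v) ≡ indicator (incidentᵇ G zero v)
    endpoint v rewrite defect-edge₀↦2 (target b) v | unchanged v with incidentᵇ G zero v
    ... | true  = refl
    ... | false = refl

  degenerate : ∀ b → twos all1 b ≡ 0 → Σ (TotalColouring G) (Admissible side)
  degenerate b none = finish (k≤m⊎3<k+m k m few)
    where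
    k = twos edge₀↦2 (b ⁻¹)
    two : twos edge₀↦2 b ≡ 2
    two = twos-edge₀↦2 b none
    few : m ≤ 1 → k ≤ m
    few m≤1 = +-cancelˡ-≤ 2 _ _
      (subst (_≤ 2 + m) (trans (sym (twos+twos⁻¹ edge₀↦2 b)) (cong (_+ k) two))
             (sparse-connected⇒≤ G conn m≤1))
    one : #1ℙ edge₀↦2 ≡ 1
    one = cong suc (trans (sumFin-const m 0) (*-zeroʳ m))
    rest : #1ℙ (λ e → edge₀↦2 e ⁻¹) ≡ m
    rest = trans (sumFin-const m 1) (*-identityʳ m)
    finish : k ≤ m ⊎ 3 < k + m → Σ (TotalColouring G) (Admissible side)
    finish (inj₁ k≤m)   =
      admissible edge₀↦2 (b ⁻¹) refl (trans (cong (twos edge₀↦2) (Parityₚ.⁻¹-involutive b)) two)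
        one rest
        (m≤n+m 1 k) (subst (_< 2 + m) (+-comm 1 k) (s≤s (s≤s k≤m)))
    finish (inj₂ 3<k+m) = admissible edge₀↦2 b two refl one rest (s≤s z≤n) 3<k+m

  fewer : ∀ b → twos all1 b ≤ twos all1 (b ⁻¹) → Σ (TotalColouring G) (Admissible side)
  fewer b t≤t⁻¹ with twos all1 b in none
  ... | zero  = degenerate b none
  ... | suc _ = balanced b (subst (0 <_) (sym none) (s≤s z≤n))
                           (subst (_≤ twos all1 (b ⁻¹)) (sym none) t≤t⁻¹)

  colouring : Σ (TotalColouring G) (Admissible side)
  colouring with ≤-total (twos all1 0ℙ) (twos all1 1ℙ)
  ... | inj₁ t₀≤t₁ = fewer 0ℙ t₀≤t₁
  ... | inj₂ t₁≤t₀ = fewer 1ℙ t₁≤t₀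

mainTheorem7 : (n m : ℕ) (G : Graph n (suc m)) → Connected G →
    (side : Fin n → Bool) → IsBipartition G side →
    Σ (TotalColouring G) λ c →
      (SideParity side c Even Odd ⊎ SideParity side c Odd Even) ×
      (0 < countColour c 2) × (countColour c 2 < countColour c 1)
mainTheorem7 n m G conn side _ = Construction.colouring G conn side
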